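{- Let $G$ be a finite $\Sigma^\circ$-labeled graph and $Z$ a zone of the zoning of $G$. If $Z$ is acyclic (contains no directed cycle), then $Z$ is a directed tree.
   Context: $\Sigma$ is a signature with arities $\#$; $\Sigma^\circ=(\Sigma\uplus\mathbb{N}^+)\uplus\{\bot,\top\}$ is the flat lattice; a $\Sigma^\circ$-labeled graph has vertices and edges labeled in $\Sigma^\circ$, with source and target maps $s,t$. A vertex $v$ is in-well-formed (I) if it has at most one incoming edge; it is out-well-formed (O) if its label $l$ lies in $\Sigma$ and $v$ has precisely $\#(l)$ outgoing edges, labeled $1,2,\ldots,\#(l)$. A vertex is good if it is O and all its children (targets of its outgoing edges) are I; otherwise it is bad. The zoning of $G$ is constructed iteratively: initially each vertex forms its own zone (a subgraph); repeatedly, if an edge $e$ is not included in any zone and $s(e)$ is good, the zones of $s(e)$ and $t(e)$ are joined along $e$ (if they are the same zone $Z$, $e$ is added to $Z$); stop when no such edge remains. -}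

module Defs where

open import Data.Nat using (ℕ)
open import Data.Fin using (Fin; toℕ; _≟_)
open import Data.Bool using (Bool; true; false; if_then_else_)
open import Data.List using (List; []; _∷_)
open import Data.Product using (_×_; ∃; _,_)
open import Relation.Nullary using (¬_)
open import Relation.Nullary.Decidable using (⌊_⌋)
open import Relation.Binary.PropositionalEquality using (_≡_)
open import Relation.Binary.Construct.Closure.ReflexiveTransitive using (Star)

record Signature : Set₁ where
  field
    Sym   : Set
    arity : Sym → ℕ
open Signature public

-- The flat lattice Σ° = (Σ ⊎ ℕ⁺) ⊎ {⊥,⊤}.
-- Convention: `pos k` denotes the positive integer k+1.
data Label (S : Signature) : Set where
  sym : Sym S → Label S
  pos : ℕ → Label S
  bot : Label S
  top : Label S

record LGraph (S : Signature) : Set where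
  field
    nV   : ℕ
    nE   : ℕ
    src  : Fin nE → Fin nV
    tgt  : Fin nE → Fin nV
    vlab : Fin nV → Label S
    elab : Fin nE → Label S

module _ {S : Signature} (G : LGraph S) where
  open LGraph G

  InWF : Fin nV → Set
  InWF v = ∀ e e' → tgt e ≡ v → tgt e' ≡ v → e ≡ e'

  -- out-well-formed: label l ∈ Σ and the outgoing edges are precisely
  -- #(l) many, labeled 1,…,#(l)  (label i+1 is `pos (toℕ i)` for i : Fin #(l))
  OutWF : Fin nV → Set
  OutWF v = ∃ λ (l : Sym S) → vlab v ≡ sym l
    × (∀ e → src e ≡ v → ∃ λ (i : Fin (arity S l)) → elab e ≡ pos (toℕ i))
    × (∀ (i : Fin (arity S l)) → ∃ λ e → src e ≡ v × elab e ≡ pos (toℕ i))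
    × (∀ e e' → src e ≡ v → src e' ≡ v → elab e ≡ elab e' → e ≡ e')

  Good : Fin nV → Set
  Good v = OutWF v × (∀ e → src e ≡ v → InWF (tgt e))

  -- State of the zoning construction: each vertex v lies in the zone with
  -- identifier zid v; inc e says whether edge e has been included in a zone.
  record State : Set where
    field
      zid : Fin nV → Fin nV
      inc : Fin nE → Bool
  open State public

  initial : State
  initial = record { zid = λ v → v ; inc = λ _ → false }

  join : State → Fin nE → State
  join st e = record
    { zid = λ v → if ⌊ zid st v ≟ zid st (tgt e) ⌋ then zid st (src e) else zid st v
    ; inc = λ e' → if ⌊ e' ≟ e ⌋ then true else inc st e' }

  data Step : State → State → Set where
    step : ∀ st e → inc st e ≡ false → Good (src e) → Step st (join st e)

  Terminal : State → Set
  Terminal st = ∀ e → inc st e ≡ false → ¬ Good (src e)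

  Zoning : State → Set
  Zoning st = Star Step initial st × Terminal st

  IsZone : State → Fin nV → Set
  IsZone st k = ∃ λ v → zid st v ≡ k

  InZ : State → Fin nV → Fin nV → Set
  InZ st k v = zid st v ≡ k

  EdgeZ : State → Fin nV → Fin nE → Set
  EdgeZ st k e = inc st e ≡ true × zid st (src e) ≡ k × zid st (tgt e) ≡ k

  IsWalk : State → Fin nV → Fin nV → Fin nV → List (Fin nE) → Set
  IsWalk st k u v [] = u ≡ v
  IsWalk st k u v (e ∷ es) = src e ≡ u × EdgeZ st k e × IsWalk st k (tgt e) v es

  Acyclic : State → Fin nV → Set
  Acyclic st k = ¬ (∃ λ v → ∃ λ e → ∃ λ es → IsWalk st k v v (e ∷ es))

  DirectedTree : State → Fin nV → Set
  DirectedTree st k = ∃ λ r → InZ st k r ×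
    (∀ v → InZ st k v → ∃ λ es → IsWalk st k r v es
       × (∀ es' → IsWalk st k r v es' → es' ≡ es))

{-# OPTIONS --safe #-}
module Submission where

-- Two invariants hold at every stage of the construction.  First, no two
-- included edges share a target: an edge e is only included when s(e) is
-- good, so t(e) is in-well-formed and e is the only edge of G entering it.
-- Second, every zone either contains a cycle or has a root that no included
-- edge enters and from which a walk inside the zone reaches each vertex of
-- the zone.  When e is included, t(e) is not yet entered, hence t(e) is the
-- root of its zone: joining two zones along e keeps the root of the zone of
-- s(e), while joining a zone to itself closes a cycle through e.  In a rooted
-- zone a walk from the root is determined by its endpoint, because it can be
-- traced back edge by edge through the unique entering included edges.

open import Defs hiding (sym)
open import Data.Fin using (Fin; _≟_)
open import Data.Bool using (true; false; if_then_else_)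
open import Data.List using ([]; _∷_; _++_; [_]; _∷ʳ_)
open import Data.List.Reverse using (Reverse; []; _∶_∶ʳ_; reverseView)
open import Data.Product using (∃; _×_; _,_; proj₂)
open import Data.Sum using (_⊎_; inj₁; inj₂)
open import Data.Empty using (⊥-elim)
open import Relation.Nullary using (yes; no)
open import Relation.Nullary.Decidable using (⌊_⌋)
open import Relation.Binary.PropositionalEquality using (_≡_; _≢_; refl; sym; trans; cong)
open import Relation.Binary.Construct.Closure.ReflexiveTransitive using (Star; ε; _◅_)

module _ {S : Signature} (G : LGraph S) where
  open LGraph G

  HasCycle : State G → Fin nV → Set
  HasCycle st k = ∃ λ v → ∃ λ e → ∃ λ es → IsWalk G st k v v (e ∷ es)

  Unentered : State G → Fin nV → Set
  Unentered st w = ∀ e → inc st e ≡ true → tgt e ≢ w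

  InDegree≤1 : State G → Set
  InDegree≤1 st = ∀ e e' → inc st e ≡ true → inc st e' ≡ true → tgt e ≡ tgt e' → e ≡ e'

  record RootedZone (st : State G) (k : Fin nV) : Set where
    field
      root           : Fin nV
      root∈zone      : InZ G st k root
      root-unentered : Unentered st root
      reach          : ∀ v → InZ G st k v → ∃ λ es → IsWalk G st k root v es

  record ZoningInvariant (st : State G) : Set where
    field
      in-degree≤1      : InDegree≤1 st
      cyclic-or-rooted : ∀ k → IsZone G st k → HasCycle st k ⊎ RootedZone st k

  module _ {st : State G} {k : Fin nV} where

    walk-++ : ∀ {u w v} es fs → IsWalk G st k u w es → IsWalk G st k w v fs →
              IsWalk G st k u v (es ++ fs)
    walk-++ []       fs refl        q = q
    walk-++ (e ∷ es) fs (s , z , p) q = s , z , walk-++ es fs p q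

    walk-++⁻ : ∀ {u v} es fs → IsWalk G st k u v (es ++ fs) →
               ∃ λ w → IsWalk G st k u w es × IsWalk G st k w v fs
    walk-++⁻ []       fs p = _ , refl , p
    walk-++⁻ (e ∷ es) fs (s , z , p) with walk-++⁻ es fs p
    ... | w , p₁ , p₂ = w , (s , z , p₁) , p₂

    walk-∷ʳ⁻ : ∀ {u v} es e → IsWalk G st k u v (es ∷ʳ e) →
               IsWalk G st k u (src e) es × EdgeZ G st k e × tgt e ≡ v
    walk-∷ʳ⁻ es e p with walk-++⁻ es [ e ] p
    ... | _ , p₁ , (refl , z , t) = p₁ , z , t

    walk-to-unentered : ∀ {u w} es → Unentered st w → IsWalk G st k u w es → u ≡ w
    walk-to-unentered []       _  p                 = p
    walk-to-unentered (e ∷ es) un (_ , (i , _) , p) = ⊥-elim (un e i (walk-to-unentered es un p))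

    module _ (in-degree≤1 : InDegree≤1 st) {r : Fin nV} (r-unentered : Unentered st r) where

      walks-from-unentered-unique′ : ∀ {v es es'} → Reverse es → Reverse es' →
        IsWalk G st k r v es → IsWalk G st k r v es' → es' ≡ es
      walks-from-unentered-unique′ [] [] _ _ = refl
      walks-from-unentered-unique′ [] (es' ∶ _ ∶ʳ e') refl q
        with _ , (i' , _) , t' ← walk-∷ʳ⁻ es' e' q = ⊥-elim (r-unentered e' i' t')
      walks-from-unentered-unique′ (es ∶ _ ∶ʳ e) [] p refl
        with _ , (i , _) , t ← walk-∷ʳ⁻ es e p = ⊥-elim (r-unentered e i t)
      walks-from-unentered-unique′ (es ∶ rs ∶ʳ e) (es' ∶ rs' ∶ʳ e') p q
        with p₁ , (i , _) , t ← walk-∷ʳ⁻ es e p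
           | q₁ , (i' , _) , t' ← walk-∷ʳ⁻ es' e' q
        with refl ← in-degree≤1 e e' i i' (trans t (sym t'))
        = cong (_∷ʳ e) (walks-from-unentered-unique′ rs rs' p₁ q₁)

      walks-from-unentered-unique : ∀ {v es es'} →
        IsWalk G st k r v es → IsWalk G st k r v es' → es' ≡ es
      walks-from-unentered-unique {es = es} {es'} =
        walks-from-unentered-unique′ (reverseView es) (reverseView es')

  rooted-zone⇒directed-tree : ∀ {st k} → InDegree≤1 st → RootedZone st k → DirectedTree G st k
  rooted-zone⇒directed-tree in-degree≤1 R = root , root∈zone , λ v v∈k →
    let es , p = reach v v∈k in
    es , p , λ _ p' → walks-from-unentered-unique in-degree≤1 root-unentered p p'
    where open RootedZone R

  module Join (st : State G) (e : Fin nE) (e∉st : inc st e ≡ false)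
              (tgt-inWF : InWF G (tgt e)) where

    st′ : State G
    st′ = join G st e

    a b : Fin nV
    a = zid st (src e)
    b = zid st (tgt e)

    -- zid st′ v reduces to relabel (zid st v)
    relabel : Fin nV → Fin nV
    relabel x = if ⌊ x ≟ b ⌋ then a else x

    relabel-≡b : ∀ {x} → x ≡ b → relabel x ≡ a
    relabel-≡b {x} x≡b with x ≟ b
    ... | yes _   = refl
    ... | no  x≢b = ⊥-elim (x≢b x≡b)

    relabel-≢b : ∀ {x} → x ≢ b → relabel x ≡ x
    relabel-≢b {x} x≢b with x ≟ b
    ... | yes x≡b = ⊥-elim (x≢b x≡b)
    ... | no  _   = refl

    relabel-a : relabel a ≡ a
    relabel-a with a ≟ b
    ... | yes _ = refl
    ... | no  _ = refl

    inc-join-self : inc st′ e ≡ true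
    inc-join-self with e ≟ e
    ... | yes _   = refl
    ... | no  e≢e = ⊥-elim (e≢e refl)

    inc-join : ∀ {e₁} → inc st e₁ ≡ true → inc st′ e₁ ≡ true
    inc-join {e₁} i with e₁ ≟ e
    ... | yes _ = refl
    ... | no  _ = i

    inc-join⁻ : ∀ {e₁} → inc st′ e₁ ≡ true → e₁ ≡ e ⊎ inc st e₁ ≡ true
    inc-join⁻ {e₁} i with e₁ ≟ e
    ... | yes e₁≡e = inj₁ e₁≡e
    ... | no  _    = inj₂ i

    edge-join : ∀ {k k' e₁} → relabel k ≡ k' → EdgeZ G st k e₁ → EdgeZ G st′ k' e₁
    edge-join k↦k' (i , s , t) = inc-join i , trans (cong relabel s) k↦k' , trans (cong relabel t) k↦k'

    walk-join : ∀ {k k' u v} es → relabel k ≡ k' → IsWalk G st k u v es → IsWalk G st′ k' u v es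
    walk-join []        _     p           = p
    walk-join (e₁ ∷ es) k↦k' (s , z , p) = s , edge-join k↦k' z , walk-join es k↦k' p

    cycle-join : ∀ {k k'} → relabel k ≡ k' → HasCycle st k → HasCycle st′ k'
    cycle-join k↦k' (v , e₁ , es , p) = v , e₁ , es , walk-join (e₁ ∷ es) k↦k' p

    e∈zone-a : EdgeZ G st′ a e
    e∈zone-a = inc-join-self , relabel-a , relabel-≡b refl

    tgt-unentered : Unentered st (tgt e)
    tgt-unentered e₁ i t with refl ← tgt-inWF e₁ e t refl
      with () ← trans (sym i) e∉st

    in-degree≤1-join : InDegree≤1 st → InDegree≤1 st′
    in-degree≤1-join in-degree≤1 e₁ e₂ i₁ i₂ t with inc-join⁻ i₁ | inc-join⁻ i₂
    ... | inj₁ refl | _         = tgt-inWF e e₂ refl (sym t)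
    ... | inj₂ _    | inj₁ refl = tgt-inWF e₁ e t refl
    ... | inj₂ j₁   | inj₂ j₂   = in-degree≤1 e₁ e₂ j₁ j₂ t

    zone-join-untouched : ∀ {k} → k ≢ a → IsZone G st′ k → IsZone G st k × k ≢ b
    zone-join-untouched k≢a (v , v∈k) with zid st v ≟ b
    ... | yes _   = ⊥-elim (k≢a (sym v∈k))
    ... | no  v∉b = (v , v∈k) , λ k≡b → v∉b (trans v∈k k≡b)

    rooted-join-untouched : ∀ {k} → k ≢ a → k ≢ b → RootedZone st k → RootedZone st′ k
    rooted-join-untouched {k} k≢a k≢b R = record
      { root           = root
      ; root∈zone      = trans (cong relabel root∈zone) (relabel-≢b k≢b)
      ; root-unentered = unentered
      ; reach          = reach′
      }
      where
        open RootedZone R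

        unentered : Unentered st′ root
        unentered e₁ i t with inc-join⁻ i
        ... | inj₁ refl = k≢b (trans (sym root∈zone) (cong (zid st) (sym t)))
        ... | inj₂ j    = root-unentered e₁ j t

        reach′ : ∀ v → InZ G st′ k v → ∃ λ es → IsWalk G st′ k root v es
        reach′ v v∈k with zid st v ≟ b
        ... | yes _ = ⊥-elim (k≢a (sym v∈k))
        ... | no  _ with es , p ← reach v v∈k
          = es , walk-join es (relabel-≢b k≢b) p

    -- the root of the zone reaches t(e) and nothing enters t(e), so the root is t(e)
    cycle-join-inside : a ≡ b → RootedZone st a → HasCycle st′ a
    cycle-join-inside a≡b R
      with refl ← walk-to-unentered _ tgt-unentered (proj₂ (RootedZone.reach R (tgt e) (sym a≡b)))
      with es , p ← RootedZone.reach R (src e) refl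
      = src e , e , es , (refl , e∈zone-a , walk-join es relabel-a p)

    rooted-join-merge : a ≢ b → RootedZone st a → RootedZone st b → RootedZone st′ a
    rooted-join-merge a≢b Ra Rb
      with refl ← walk-to-unentered _ tgt-unentered (proj₂ (RootedZone.reach Rb (tgt e) refl))
      = record
        { root           = root
        ; root∈zone      = trans (cong relabel root∈zone) relabel-a
        ; root-unentered = unentered
        ; reach          = reach′
        }
      where
        open RootedZone Ra

        unentered : Unentered st′ root
        unentered e₁ i t with inc-join⁻ i
        ... | inj₁ refl = a≢b (trans (sym root∈zone) (cong (zid st) (sym t)))
        ... | inj₂ j    = root-unentered e₁ j t

        reach′ : ∀ v → InZ G st′ a v → ∃ λ es → IsWalk G st′ a root v es
        reach′ v v∈a with zid st v ≟ b
        ... | no _ with es , p ← reach v v∈a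
          = es , walk-join es relabel-a p
        ... | yes v∈b with es₁ , p₁ ← reach (src e) refl
                         | es₂ , p₂ ← RootedZone.reach Rb v v∈b
          = es₁ ++ e ∷ es₂
          , walk-++ es₁ (e ∷ es₂) (walk-join es₁ relabel-a p₁)
                                  (refl , e∈zone-a , walk-join es₂ (relabel-≡b refl) p₂)

    cyclic-or-rooted-join : ZoningInvariant st →
      ∀ k → IsZone G st′ k → HasCycle st′ k ⊎ RootedZone st′ k
    cyclic-or-rooted-join I k k-zone with k ≟ a
    ... | no k≢a with (k-zone₀ , k≢b) ← zone-join-untouched k≢a k-zone
      with ZoningInvariant.cyclic-or-rooted I k k-zone₀
    ... | inj₁ c = inj₁ (cycle-join (relabel-≢b k≢b) c)
    ... | inj₂ R = inj₂ (rooted-join-untouched k≢a k≢b R)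
    cyclic-or-rooted-join I k k-zone | yes refl
      with ZoningInvariant.cyclic-or-rooted I a (src e , refl)
         | ZoningInvariant.cyclic-or-rooted I b (tgt e , refl) | a ≟ b
    ... | inj₁ c  | _       | _       = inj₁ (cycle-join relabel-a c)
    ... | inj₂ Ra | _       | yes a≡b = inj₁ (cycle-join-inside a≡b Ra)
    ... | inj₂ _  | inj₁ c  | no  _   = inj₁ (cycle-join (relabel-≡b refl) c)
    ... | inj₂ Ra | inj₂ Rb | no  a≢b = inj₂ (rooted-join-merge a≢b Ra Rb)

    invariant-join : ZoningInvariant st → ZoningInvariant st′
    invariant-join I = record
      { in-degree≤1      = in-degree≤1-join (ZoningInvariant.in-degree≤1 I)
      ; cyclic-or-rooted = cyclic-or-rooted-join I
      }

  invariant-initial : ZoningInvariant (initial G)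
  invariant-initial = record
    { in-degree≤1      = λ _ _ ()
    ; cyclic-or-rooted = λ k _ → inj₂ (record
        { root = k ; root∈zone = refl ; root-unentered = λ _ ()
        ; reach = λ v v∈k → [] , sym v∈k })
    }

  invariant-steps : ∀ {x y} → Star (Step G) x y → ZoningInvariant x → ZoningInvariant y
  invariant-steps ε                         I = I
  invariant-steps (step st e e∉st good ◅ steps) I =
    invariant-steps steps (Join.invariant-join st e e∉st (proj₂ good e refl) I)

proposition56 : ∀ {S : Signature} (G : LGraph S) (st : State G) → Zoning G st →
    ∀ k → IsZone G st k → Acyclic G st k → DirectedTree G st k
proposition56 G st (steps , _) k k-zone acyclic
  with I ← invariant-steps G steps (invariant-initial G)
  with ZoningInvariant.cyclic-or-rooted I k k-zone
... | inj₁ cycle = ⊥-elim (acyclic cycle)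
... | inj₂ R     = rooted-zone⇒directed-tree G (ZoningInvariant.in-degree≤1 I) R
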